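{- For every definition set $D$, choreographies $C,C_1,C_2$, states $s,s_1,s_2$ and rich labels $\rho_1,\rho_2$: if $\langle C,s\rangle\xrightarrow{\rho_1}_D\langle C_1,s_1\rangle$, $\langle C,s\rangle\xrightarrow{\rho_2}_D\langle C_2,s_2\rangle$ and $\rho_1=\rho_2$, then $C_1=C_2$ and $s_1\equiv s_2$.
   Context: Fix types with decidable equality of process names $\mathsf{Pid}$, variables $\mathsf{Var}$, values $\mathsf{Val}$, expressions, Boolean expressions, procedure names $\mathsf{RecVar}$, annotations, and evaluation functions $\mathrm{eval}$ (expression and local state $\mathsf{Var}\to\mathsf{Val}$ to value) and $\mathrm{beval}$ (Boolean expression and local state to Boolean), invariant under extensional equality of local states. Labels: $\mathsf{left},\mathsf{right}$. A state is $s:\mathsf{Pid}\to\mathsf{Var}\to\mathsf{Val}$; $s\equiv s'$ is extensional equality; $s[q,x\mapsto v]$ is update. Interactions $\eta::=p.e\to q.x\mid p\to q[l]$ (processes $\{p,q\}$); choreographies $C::=\eta@a;C\mid\mathsf{if}\ p.b\ \mathsf{then}\ C_1\ \mathsf{else}\ C_2\mid\mathsf{call}\ X\mid\mathsf{rtcall}\ X\ ps\ C\mid\mathsf{end}$, $ps$ a list of processes. A definition set is $D:\mathsf{RecVar}\to\mathrm{list}(\mathsf{Pid})\times\mathsf{Chor}$, $D\,X=(\mathrm{Vars}\,X,\mathrm{Body}\,X)$. Rich labels $\mathrm{com}(p,v,q,x),\mathrm{sel}(p,q,l),\mathrm{cond}(p),\mathrm{call}(X,p)$ with processes $\{p,q\},\{p,q\},\{p\},\{p\}$.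 $\langle C,s\rangle\xrightarrow{\rho}_D\langle C',s'\rangle$ is the least relation with: $\langle p.e\to q.x@a;C,s\rangle\xrightarrow{\mathrm{com}(p,v,q,x)}\langle C,s'\rangle$ if $v=\mathrm{eval}(e,s\,p)$, $s'\equiv s[q,x\mapsto v]$; $\langle p\to q[l]@a;C,s\rangle\xrightarrow{\mathrm{sel}(p,q,l)}\langle C,s'\rangle$ if $s\equiv s'$; $\langle\mathsf{if}\ p.b\ \mathsf{then}\ C_1\ \mathsf{else}\ C_2,s\rangle\xrightarrow{\mathrm{cond}(p)}\langle C_1,s'\rangle$ (resp. $C_2$) if $\mathrm{beval}(b,s\,p)$ is true (resp. false), $s\equiv s'$; $\langle\eta@a;C,s\rangle\xrightarrow{\rho}\langle\eta@a;C',s'\rangle$ if $\langle C,s\rangle\xrightarrow{\rho}\langle C',s'\rangle$ and processes of $\eta$, $\rho$ are disjoint; $\langle\mathsf{if}\ p.b\ \mathsf{then}\ C_1\ \mathsf{else}\ C_2,s\rangle\xrightarrow{\rho}\langle\mathsf{if}\ p.b\ \mathsf{then}\ C_1'\ \mathsf{else}\ C_2',s'\rangle$ if $p$ not in $\rho$ and $\langle C_i,s\rangle\xrightarrow{\rho}\langle C_i',s'\rangle$, $i=1,2$; $\langle\mathsf{rtcall}\ X\ ps\ C,s\rangle\xrightarrow{\rho}\langle\mathsf{rtcall}\ X\ ps\ C',s'\rangle$ if no process of $\rho$ is in $ps$ and $\langle C,s\rangle\xrightarrow{\rho}\langle C',s'\rangle$; for $s\equiv s'$, $p\in\mathrm{Vars}\,X$: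 $\langle\mathsf{call}\ X,s\rangle\xrightarrow{\mathrm{call}(X,p)}\langle\mathrm{Body}\,X,s'\rangle$ if $\#\mathrm{Vars}\,X=1$, and $\langle\mathsf{rtcall}\ X\ (\mathrm{Vars}\,X\setminus p)\ (\mathrm{Body}\,X),s'\rangle$ if $\#\mathrm{Vars}\,X>1$; for $s\equiv s'$, $p\in ps$: $\langle\mathsf{rtcall}\ X\ ps\ C,s\rangle\xrightarrow{\mathrm{call}(X,p)}\langle\mathsf{rtcall}\ X\ (ps\setminus p)\ C,s'\rangle$ if $\#ps>1$ and $\langle C,s'\rangle$ if $\#ps=1$ ($\#$ is list size, $\setminus p$ removes $p$). -}

module Defs where

open import Data.Bool using (Bool; true; false; if_then_else_; _∧_)
open import Data.Nat using (ℕ; _>_)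
open import Data.List using (List; []; _∷_; length; filter)
open import Data.List.Membership.Propositional using (_∈_; _∉_)
open import Data.Product using (_×_; _,_)
open import Relation.Nullary using (¬_; ⌊_⌋)
open import Relation.Nullary.Decidable using (¬?)
open import Relation.Binary using (DecidableEquality)
open import Relation.Binary.PropositionalEquality using (_≡_)

record Params : Set₁ where
  field
    Pid Var Val Expr BExpr RecVar Ann : Set
    _≟Pid_ : DecidableEquality Pid
    _≟Var_ : DecidableEquality Var
    _≟Val_ : DecidableEquality Val
    _≟Expr_ : DecidableEquality Expr
    _≟BExpr_ : DecidableEquality BExpr
    _≟RecVar_ : DecidableEquality RecVar
    _≟Ann_ : DecidableEquality Ann
    eval  : Expr → (Var → Val) → Val
    beval : BExpr → (Var → Val) → Bool
    eval-ext  : ∀ e (f g : Var → Val) → (∀ x → f x ≡ g x) → eval e f ≡ eval e g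
    beval-ext : ∀ b (f g : Var → Val) → (∀ x → f x ≡ g x) → beval b f ≡ beval b g

data Label : Set where
  left right : Label

module Lang (P : Params) where
  open Params P

  State : Set
  State = Pid → Var → Val

  _≡ₛ_ : State → State → Set
  s ≡ₛ s' = ∀ p x → s p x ≡ s' p x

  upd : State → Pid → Var → Val → State
  upd s q x v p y = if ⌊ p ≟Pid q ⌋ ∧ ⌊ y ≟Var x ⌋ then v else s p y

  _∖_ : List Pid → Pid → List Pid
  ps ∖ p = filter (λ q → ¬? (q ≟Pid p)) ps

  data Interaction : Set where
    com : Pid → Expr → Pid → Var → Interaction
    sel : Pid → Pid → Label → Interaction

  procI : Interaction → List Pid
  procI (com p _ q _) = p ∷ q ∷ []
  procI (sel p q _)   = p ∷ q ∷ []

  data Chor : Set where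
    _at_⨾_ : Interaction → Ann → Chor → Chor
    ifc    : Pid → BExpr → Chor → Chor → Chor
    call   : RecVar → Chor
    rtcall : RecVar → List Pid → Chor → Chor
    end    : Chor

  DefSet : Set
  DefSet = RecVar → List Pid × Chor

  Vars : DefSet → RecVar → List Pid
  Vars D X with D X
  ... | (ps , _) = ps

  Body : DefSet → RecVar → Chor
  Body D X with D X
  ... | (_ , B) = B

  data RichLabel : Set where
    lcom  : Pid → Val → Pid → Var → RichLabel
    lsel  : Pid → Pid → Label → RichLabel
    lcond : Pid → RichLabel
    lcall : RecVar → Pid → RichLabel

  procR : RichLabel → List Pid
  procR (lcom p _ q _) = p ∷ q ∷ []
  procR (lsel p q _)   = p ∷ q ∷ []
  procR (lcond p)      = p ∷ []
  procR (lcall _ p)    = p ∷ []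

  Disjoint : List Pid → List Pid → Set
  Disjoint xs ys = ∀ {r} → r ∈ xs → r ∉ ys

  data Step (D : DefSet) : Chor → State → RichLabel → Chor → State → Set where
    s-com : ∀ {p e q x a C s s' v} →
      v ≡ eval e (s p) → s' ≡ₛ upd s q x v →
      Step D (com p e q x at a ⨾ C) s (lcom p v q x) C s'
    s-sel : ∀ {p q l a C s s'} → s ≡ₛ s' →
      Step D (sel p q l at a ⨾ C) s (lsel p q l) C s'
    s-then : ∀ {p b C₁ C₂ s s'} → beval b (s p) ≡ true → s ≡ₛ s' →
      Step D (ifc p b C₁ C₂) s (lcond p) C₁ s'
    s-else : ∀ {p b C₁ C₂ s s'} → beval b (s p) ≡ false → s ≡ₛ s' →
      Step D (ifc p b C₁ C₂) s (lcond p) C₂ s'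
    s-delay-int : ∀ {η a C C' s s' ρ} → Disjoint (procI η) (procR ρ) →
      Step D C s ρ C' s' →
      Step D (η at a ⨾ C) s ρ (η at a ⨾ C') s'
    s-delay-if : ∀ {p b C₁ C₂ C₁' C₂' s s' ρ} → p ∉ procR ρ →
      Step D C₁ s ρ C₁' s' → Step D C₂ s ρ C₂' s' →
      Step D (ifc p b C₁ C₂) s ρ (ifc p b C₁' C₂') s'
    s-delay-rt : ∀ {X ps C C' s s' ρ} → Disjoint (procR ρ) ps →
      Step D C s ρ C' s' →
      Step D (rtcall X ps C) s ρ (rtcall X ps C') s'
    s-call-one : ∀ {X p s s'} → s ≡ₛ s' → p ∈ Vars D X →
      length (Vars D X) ≡ 1 →
      Step D (call X) s (lcall X p) (Body D X) s'
    s-call-many : ∀ {X p s s'} → s ≡ₛ s' → p ∈ Vars D X →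
      length (Vars D X) > 1 →
      Step D (call X) s (lcall X p) (rtcall X (Vars D X ∖ p) (Body D X)) s'
    s-rt-many : ∀ {X ps C p s s'} → s ≡ₛ s' → p ∈ ps → length ps > 1 →
      Step D (rtcall X ps C) s (lcall X p) (rtcall X (ps ∖ p) C) s'
    s-rt-one : ∀ {X ps C p s s'} → s ≡ₛ s' → p ∈ ps → length ps ≡ 1 →
      Step D (rtcall X ps C) s (lcall X p) C s'

-- Every rule is determined by the shape of the choreography, except where two
-- rules share a redex; those overlaps are all ruled out by the label: the
-- acting process of a communication, selection, conditional or runtime call
-- is exactly the one a delay rule forbids, the two branches of a conditional
-- need opposite values of the guard, and the one/many variants of a call
-- need incompatible list lengths. Congruence cases follow by induction, and
-- all final states are extensionally equal to a common one.
module Submission where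

open import Defs
open import Data.Empty using (⊥-elim)
open import Data.List.Relation.Unary.Any using (here)
open import Data.Nat.Properties using (<-irrefl)
open import Data.Product using (_×_; _,_)
open import Relation.Binary.PropositionalEquality using (_≡_; refl; sym; trans)

module Determinism (P : Params) where
  open Lang P

  ≡ₛ-sym : ∀ {s s'} → s ≡ₛ s' → s' ≡ₛ s
  ≡ₛ-sym e p x = sym (e p x)

  ≡ₛ-trans : ∀ {s s' s''} → s ≡ₛ s' → s' ≡ₛ s'' → s ≡ₛ s''
  ≡ₛ-trans e e' p x = trans (e p x) (e' p x)

  ≡ₛ-from-common : ∀ {s s₁ s₂} → s ≡ₛ s₁ → s ≡ₛ s₂ → s₁ ≡ₛ s₂
  ≡ₛ-from-common e₁ e₂ = ≡ₛ-trans (≡ₛ-sym e₁) e₂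

  ≡ₛ-to-common : ∀ {s s₁ s₂} → s₁ ≡ₛ s → s₂ ≡ₛ s → s₁ ≡ₛ s₂
  ≡ₛ-to-common e₁ e₂ = ≡ₛ-trans e₁ (≡ₛ-sym e₂)

  step-deterministic : ∀ {D C s ρ C₁ C₂ s₁ s₂} →
    Step D C s ρ C₁ s₁ → Step D C s ρ C₂ s₂ → C₁ ≡ C₂ × s₁ ≡ₛ s₂
  step-deterministic (s-com refl e₁) (s-com refl e₂) = refl , ≡ₛ-to-common e₁ e₂
  step-deterministic (s-sel e₁)      (s-sel e₂)      = refl , ≡ₛ-from-common e₁ e₂
  step-deterministic (s-then _ e₁)   (s-then _ e₂)   = refl , ≡ₛ-from-common e₁ e₂
  step-deterministic (s-else _ e₁)   (s-else _ e₂)   = refl , ≡ₛ-from-common e₁ e₂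
  step-deterministic (s-call-one e₁ _ _)  (s-call-one e₂ _ _)  = refl , ≡ₛ-from-common e₁ e₂
  step-deterministic (s-call-many e₁ _ _) (s-call-many e₂ _ _) = refl , ≡ₛ-from-common e₁ e₂
  step-deterministic (s-rt-many e₁ _ _)   (s-rt-many e₂ _ _)   = refl , ≡ₛ-from-common e₁ e₂
  step-deterministic (s-rt-one e₁ _ _)    (s-rt-one e₂ _ _)    = refl , ≡ₛ-from-common e₁ e₂

  step-deterministic (s-delay-int _ t₁) (s-delay-int _ t₂)
    with step-deterministic t₁ t₂
  ... | refl , e = refl , e
  step-deterministic (s-delay-if _ t₁ u₁) (s-delay-if _ t₂ u₂)
    with step-deterministic t₁ t₂ | step-deterministic u₁ u₂
  ... | refl , e | refl , _ = refl , e
  step-deterministic (s-delay-rt _ t₁) (s-delay-rt _ t₂)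
    with step-deterministic t₁ t₂
  ... | refl , e = refl , e

  step-deterministic (s-com _ _)       (s-delay-int d _) = ⊥-elim (d (here refl) (here refl))
  step-deterministic (s-delay-int d _) (s-com _ _)       = ⊥-elim (d (here refl) (here refl))
  step-deterministic (s-sel _)         (s-delay-int d _) = ⊥-elim (d (here refl) (here refl))
  step-deterministic (s-delay-int d _) (s-sel _)         = ⊥-elim (d (here refl) (here refl))

  step-deterministic (s-then _ _)       (s-delay-if p∉ _ _) = ⊥-elim (p∉ (here refl))
  step-deterministic (s-else _ _)       (s-delay-if p∉ _ _) = ⊥-elim (p∉ (here refl))
  step-deterministic (s-delay-if p∉ _ _) (s-then _ _)       = ⊥-elim (p∉ (here refl))
  step-deterministic (s-delay-if p∉ _ _) (s-else _ _)       = ⊥-elim (p∉ (here refl))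
  step-deterministic (s-then b₁ _) (s-else b₂ _) with trans (sym b₁) b₂
  ... | ()
  step-deterministic (s-else b₁ _) (s-then b₂ _) with trans (sym b₁) b₂
  ... | ()

  step-deterministic (s-rt-many _ p∈ _) (s-delay-rt d _)   = ⊥-elim (d (here refl) p∈)
  step-deterministic (s-rt-one _ p∈ _)  (s-delay-rt d _)   = ⊥-elim (d (here refl) p∈)
  step-deterministic (s-delay-rt d _)   (s-rt-many _ p∈ _) = ⊥-elim (d (here refl) p∈)
  step-deterministic (s-delay-rt d _)   (s-rt-one _ p∈ _)  = ⊥-elim (d (here refl) p∈)

  step-deterministic (s-call-one _ _ ≡1) (s-call-many _ _ >1) = ⊥-elim (<-irrefl (sym ≡1) >1)
  step-deterministic (s-call-many _ _ >1) (s-call-one _ _ ≡1) = ⊥-elim (<-irrefl (sym ≡1) >1)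
  step-deterministic (s-rt-one _ _ ≡1)   (s-rt-many _ _ >1)   = ⊥-elim (<-irrefl (sym ≡1) >1)
  step-deterministic (s-rt-many _ _ >1)  (s-rt-one _ _ ≡1)    = ⊥-elim (<-irrefl (sym ≡1) >1)

mainTheorem5 : (P : Params) → let open Lang P in
    ∀ (D : DefSet) (C C₁ C₂ : Chor) (s s₁ s₂ : State) (ρ₁ ρ₂ : RichLabel) →
    Step D C s ρ₁ C₁ s₁ → Step D C s ρ₂ C₂ s₂ → ρ₁ ≡ ρ₂ →
    C₁ ≡ C₂ × s₁ ≡ₛ s₂
mainTheorem5 P D C C₁ C₂ s s₁ s₂ ρ .ρ t₁ t₂ refl = Determinism.step-deterministic P t₁ t₂
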